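{- Let $A$ be a commutative (not necessarily unital) $\mathbb K$-algebra, $n\ge0$, and $QS^{(n)}(A):=\bigoplus_{p\le n}A^{\otimes p}\subset QS(A)$. For every element $f\in\mathbf{Car}$ that is $0$-connected (i.e. acts as zero on $A^{\otimes 0}=\mathbb K$), the power $f^{n+1}$ (taken in the product of $\widehat{\mathbf{WQSym}}$) acts as the zero operator on $QS^{(n)}(A)$.
   Context: $\mathbb K$ is a field of characteristic zero. A packed word $u=u_1\cdots u_m$ is a word over the positive integers with letter set $\{1,\dots,k\}$, $k=\max(u)$, identified with the surjection $[m]\to[k]$. $\mathbf{WQSym}$ has basis $\mathbf M_u$ ($u$ packed, including the empty word, $\mathbf M_\emptyset=1$) with product $\mathbf M_u\mathbf M_v=\sum\mathbf M_w$ over packed words $w=u'v'$ with $\mathrm{pack}(u')=u$, $\mathrm{pack}(v')=v$ ($\mathrm{pack}$ replaces the $i$-th smallest letter by $i$). $\widehat{\mathbf{WQSym}}$ is its completion for the grading by word length (formal infinite sums $\sum_u c_u\mathbf M_u$). It acts on the right on $QS(A)=\bigoplus_{p\ge0}A^{\otimes p}$ by $(a_1\otimes\cdots\otimes a_p)\mathbf M_u=\delta_{l(u)}^{p}\,b_1\otimes\cdots\otimes b_k$, $b_i=\prod_{u(j)=i}a_j$ (only finitely many terms act on each tensor). Let $I=\sum_{n\ge0}\mathbf M_{12\cdots n}$ (which acts as the identity of $QS(A)$); $\mathbf{Car}$ is the (topologically closed) subalgebra of $\widehat{\mathbf{WQSym}}$ generated by $I$. -}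

module Defs where

open import Level using (Level; _⊔_) renaming (suc to lsuc)
open import Algebra.Bundles using (CommutativeRing)
open import Algebra.Module.Bundles using (Module)
open import Data.Nat as ℕ using (ℕ; zero; suc; _≤_; _<?_; _≟_) renaming (_⊔_ to _⊔ℕ_)
open import Data.List using (List; []; _∷_; _++_; length; map; filter; upTo; take; drop; foldr; zip; concatMap; deduplicate)
open import Data.List.Properties using (≡-dec)
open import Data.List.Relation.Binary.Pointwise using (Pointwise)
open import Data.List.Relation.Unary.All using (All)
open import Data.Maybe using (Maybe; just; nothing; maybe)
open import Data.Product using (_×_; _,_; proj₁; proj₂; ∃)
open import Relation.Nullary using (Dec; ¬_)
open import Relation.Nullary.Decidable using (⌊_⌋)
open import Relation.Binary.PropositionalEquality using (_≡_)

record Field (c ℓ : Level) : Set (lsuc (c ⊔ ℓ)) where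
  field
    commRing : CommutativeRing c ℓ
  open CommutativeRing commRing public
  field
    0≉1     : ¬ (0# ≈ 1#)
    inverse : ∀ x → ¬ (x ≈ 0#) → ∃ λ y → (x * y) ≈ 1#

module _ {c ℓ} (K : Field c ℓ) where
  open Field K

  natScalar : ℕ → Carrier
  natScalar zero    = 0#
  natScalar (suc n) = 1# + natScalar n

  CharZero : Set ℓ
  CharZero = ∀ n → natScalar n ≈ 0# → n ≡ 0

record CommAlgebra {c ℓ} (K : Field c ℓ) (a ℓa : Level)
       : Set (c ⊔ ℓ ⊔ lsuc (a ⊔ ℓa)) where
  open Field K
  field
    module′ : Module commRing a ℓa
  open Module module′ public
  infixl 7 _·_
  field
    _·_      : Carrierᴹ → Carrierᴹ → Carrierᴹ
    ·-cong   : ∀ {x y u v} → x ≈ᴹ y → u ≈ᴹ v → (x · u) ≈ᴹ (y · v)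
    ·-assoc  : ∀ x y z → ((x · y) · z) ≈ᴹ (x · (y · z))
    ·-comm   : ∀ x y → (x · y) ≈ᴹ (y · x)
    ·-distribʳ : ∀ x y z → ((x +ᴹ y) · z) ≈ᴹ ((x · z) +ᴹ (y · z))
    ·-scalarˡ  : ∀ (k : Carrier) x y → ((k *ₗ x) · y) ≈ᴹ (k *ₗ (x · y))

-- Words, packing, packed words.  Letters are positive integers.

Word : Set
Word = List ℕ

-- pack: replace the i-th smallest letter by i
pack : Word → Word
pack w = map (λ x → suc (length (deduplicate _≟_ (filter (_<? x) w)))) w

IsPacked : Word → Set
IsPacked w = pack w ≡ w

isPacked? : (w : Word) → Dec (IsPacked w)
isPacked? w = ≡-dec _≟_ (pack w) w

allWords : ℕ → ℕ → List Word
allWords zero    k = [] ∷ []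
allWords (suc p) k = concatMap (λ x → map (x ∷_) (allWords p k)) (map suc (upTo k))

packedWords : ℕ → List Word
packedWords p = filter isPacked? (allWords p p)

idWord : ℕ → Word
idWord n = map suc (upTo n)

maxLetter : Word → ℕ
maxLetter = foldr _⊔ℕ_ 0

-- The completion of WQSym: formal series  Σ_u c_u M_u ,
-- represented by the coefficient function (only values on packed
-- words matter).

module Series {c ℓ} (K : Field c ℓ) where
  open Field K

  Ser : Set c
  Ser = Word → Carrier

  _≈S_ : Ser → Ser → Set ℓ
  f ≈S g = ∀ w → IsPacked w → f w ≈ g w

  sumK : List Carrier → Carrier
  sumK = foldr _+_ 0#

  zeroS : Ser
  zeroS _ = 0#

  _+S_ : Ser → Ser → Ser
  (f +S g) w = f w + g w

  _·S_ : Carrier → Ser → Ser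
  (k ·S f) w = k * f w

  oneS : Ser
  oneS w = if ⌊ ≡-dec _≟_ w [] ⌋ then 1# else 0#
    where open import Data.Bool using (if_then_else_)

  -- product: M_u M_v = Σ_{w = u'v', pack u' = u, pack v' = v} M_w ;
  -- coefficient of M_w in f g is Σ_{i=0}^{|w|} f(pack(w[..i])) g(pack(w[i..]))
  _*S_ : Ser → Ser → Ser
  (f *S g) w = sumK (map (λ i → f (pack (take i w)) * g (pack (drop i w)))
                         (upTo (suc (length w))))

  powS : Ser → ℕ → Ser
  powS f zero    = oneS
  powS f (suc m) = f *S powS f m

  I : Ser
  I w = if ⌊ ≡-dec _≟_ w (idWord (length w)) ⌋ then 1# else 0#
    where open import Data.Bool using (if_then_else_)

  polyI : List Carrier → Ser
  polyI []       = zeroS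
  polyI (k ∷ ks) = (k ·S oneS) +S (I *S polyI ks)

  -- Car: topological closure (for the word-length grading) of the
  -- subalgebra generated by I: f agrees with some polynomial in I up to
  -- any given degree N.
  Car : Ser → Set (c ⊔ ℓ)
  Car f = ∀ (N : ℕ) → ∃ λ (ks : List Carrier) →
            ∀ w → IsPacked w → length w ≤ N → f w ≈ polyI ks w

-- QS(A) = ⊕_p A^{⊗p}, presented as formal linear combinations of pure
-- tensors a₁⊗...⊗a_p modulo the K-vector-space axioms and
-- multilinearity.  The action of a series on QS(A).

module QS {c ℓ a ℓa} (K : Field c ℓ) (A : CommAlgebra K a ℓa) where
  open Field K
  open CommAlgebra A
  open Series K

  infixl 6 _⊕_
  infixr 7 _⊙_
  data Tm : Set (c ⊔ a) where
    0t   : Tm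
    _⊕_  : Tm → Tm → Tm
    _⊙_  : Carrier → Tm → Tm
    pure : List Carrierᴹ → Tm     -- a₁ ⊗ ... ⊗ a_p  (p = length)

  infix 4 _≋_
  data _≋_ : Tm → Tm → Set (c ⊔ ℓ ⊔ a ⊔ ℓa) where
    ≋-refl  : ∀ {x} → x ≋ x
    ≋-sym   : ∀ {x y} → x ≋ y → y ≋ x
    ≋-trans : ∀ {x y z} → x ≋ y → y ≋ z → x ≋ z
    ⊕-cong  : ∀ {x y u v} → x ≋ y → u ≋ v → x ⊕ u ≋ y ⊕ v
    ⊙-cong  : ∀ {k l x y} → k ≈ l → x ≋ y → k ⊙ x ≋ l ⊙ y
    ⊕-assoc : ∀ x y z → (x ⊕ y) ⊕ z ≋ x ⊕ (y ⊕ z)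
    ⊕-comm  : ∀ x y → x ⊕ y ≋ y ⊕ x
    ⊕-idˡ   : ∀ x → 0t ⊕ x ≋ x
    ⊙-one   : ∀ x → 1# ⊙ x ≋ x
    ⊙-zero  : ∀ x → 0# ⊙ x ≋ 0t
    ⊙-assoc : ∀ k l x → k ⊙ (l ⊙ x) ≋ (k * l) ⊙ x
    ⊙-distˡ : ∀ k x y → k ⊙ (x ⊕ y) ≋ k ⊙ x ⊕ k ⊙ y
    ⊙-distʳ : ∀ k l x → (k + l) ⊙ x ≋ k ⊙ x ⊕ l ⊙ x
    pure-cong : ∀ {as bs} → Pointwise _≈ᴹ_ as bs → pure as ≋ pure bs
    pure-add  : ∀ as x y bs →
      pure (as ++ (x +ᴹ y) ∷ bs) ≋ pure (as ++ x ∷ bs) ⊕ pure (as ++ y ∷ bs)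
    pure-scal : ∀ as k x bs →
      pure (as ++ (k *ₗ x) ∷ bs) ≋ k ⊙ pure (as ++ x ∷ bs)

  InDeg≤ : ℕ → Tm → Set
  InDeg≤ n 0t        = Data.Unit.⊤ where import Data.Unit
  InDeg≤ n (x ⊕ y)   = InDeg≤ n x × InDeg≤ n y
  InDeg≤ n (k ⊙ x)   = InDeg≤ n x
  InDeg≤ n (pure as) = length as ≤ n

  -- product of a (nonempty) list in the non-unital algebra
  prodM : List Carrierᴹ → Maybe Carrierᴹ
  prodM []       = nothing
  prodM (x ∷ xs) = just (maybe (λ y → x · y) x (prodM xs))

  seqM : List (Maybe Carrierᴹ) → Maybe (List Carrierᴹ)
  seqM []             = just []
  seqM (nothing ∷ ms) = nothing
  seqM (just x ∷ ms)  = maybe (λ xs → just (x ∷ xs)) nothing (seqM ms)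

  -- (a₁⊗...⊗a_p) M_u = b₁⊗...⊗b_k ,  b_i = Π_{u(j)=i} a_j
  -- (for a packed u of length p, every b_i is a nonempty product)
  blockTensor : Word → List Carrierᴹ → Tm
  blockTensor u as =
    maybe pure 0t
      (seqM (map (λ i → prodM (map proj₂ (filter (λ la → proj₁ la ≟ i) (zip u as))))
                 (idWord (maxLetter u))))

  sumTm : List Tm → Tm
  sumTm = foldr _⊕_ 0t

  act : Ser → Tm → Tm
  act f 0t        = 0t
  act f (x ⊕ y)   = act f x ⊕ act f y
  act f (k ⊙ x)   = k ⊙ act f x
  act f (pure as) = sumTm (map (λ u → f u ⊙ blockTensor u as)
                               (packedWords (length as)))

  ActsAsZeroOn≤ : ℕ → Ser → Set (c ⊔ ℓ ⊔ a ⊔ ℓa)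
  ActsAsZeroOn≤ n f = ∀ t → InDeg≤ n t → act f t ≋ 0t

  ZeroConnected : Ser → Set (c ⊔ ℓ ⊔ a ⊔ ℓa)
  ZeroConnected f = ActsAsZeroOn≤ 0 f

-- If f is 0-connected its constant coefficient f(∅) vanishes, since f(∅) is exactly how f
-- acts on A^{⊗0} = K.  The coefficient of M_w in a product g h is a sum of terms
-- g(pack u′) h(pack v′) over the factorisations w = u′v′, so if g vanishes on words shorter
-- than p and h on words shorter than q, then g h vanishes on words shorter than p + q.
-- Hence f^{n+1} vanishes on all words of length ≤ n, and M_u only acts on tensors of
-- length l(u).
module Submission where

open import Defs
open import Level using (Level)
open import Data.Nat using (ℕ; suc)
open import Data.Nat as ℕ using (zero; _∸_; _≤_; _<_; _<?_; _⊓_; z≤n; s≤s)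
open import Data.Nat.Properties as ℕ using ()
open import Data.List using ([]; _∷_; _++_; length; map; take; drop; upTo; concatMap)
open import Data.List.Properties using (length-map; length-take; length-drop)
open import Data.List.Relation.Unary.All as All using (All; []; _∷_)
open import Data.List.Relation.Unary.All.Properties using (++⁺; map⁺; filter⁺)
open import Data.List.Relation.Binary.Pointwise using (Pointwise; []; _∷_)
open import Data.Product using (_,_)
open import Relation.Nullary using (yes; no)
open import Relation.Binary.PropositionalEquality as ≡ using (_≡_)

length-pack : ∀ w → length (pack w) ≡ length w
length-pack w = length-map _ w

length-allWords : ∀ p k → All (λ u → length u ≡ p) (allWords p k)
length-allWords zero    k = ≡.refl ∷ []
length-allWords (suc p) k = go (map suc (upTo k))
  where
  go : ∀ xs → All (λ u → length u ≡ suc p)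
                  (concatMap (λ x → map (x ∷_) (allWords p k)) xs)
  go []       = []
  go (x ∷ xs) = ++⁺ (map⁺ (All.map (≡.cong suc) (length-allWords p k))) (go xs)

length-packedWords : ∀ p → All (λ u → length u ≡ p) (packedWords p)
length-packedWords p = filter⁺ isPacked? (length-allWords p p)

module Vanishing {c ℓ} (K : Field c ℓ) where
  open Field K
  open Series K

  VanishesBelow : ℕ → Ser → Set ℓ
  VanishesBelow p f = ∀ w → length w < p → f w ≈ 0#

  sumK-map-≈0 : ∀ {A : Set} (g : A → Carrier) → (∀ x → g x ≈ 0#) →
                ∀ xs → sumK (map g xs) ≈ 0#
  sumK-map-≈0 g g≈0 []       = refl
  sumK-map-≈0 g g≈0 (x ∷ xs) = trans (+-cong (g≈0 x) (sumK-map-≈0 g g≈0 xs))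
                                     (+-identityʳ 0#)

  *S-vanishesBelow : ∀ {p q f g} → VanishesBelow p f → VanishesBelow q g →
                     VanishesBelow (p ℕ.+ q) (f *S g)
  *S-vanishesBelow {p} {q} {f} {g} f≈0 g≈0 w |w|<p+q =
    sumK-map-≈0 _ term (upTo (suc (length w)))
    where
    term : ∀ i → f (pack (take i w)) * g (pack (drop i w)) ≈ 0#
    term i with length (take i w) <? p
    ... | yes short = trans (*-congʳ (f≈0 (pack (take i w)) left-short)) (zeroˡ _)
      where
      left-short : length (pack (take i w)) < p
      left-short = ≡.subst (_< p) (≡.sym (length-pack (take i w))) short
    ... | no ¬short = trans (*-congˡ (g≈0 (pack (drop i w)) right-short)) (zeroʳ _)
      where
      p≤i⊓|w| : p ≤ i ⊓ length w
      p≤i⊓|w| = ≡.subst (p ≤_) (length-take i w) (ℕ.≮⇒≥ ¬short)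

      right-short : length (pack (drop i w)) < q
      right-short = begin-strict
        length (pack (drop i w)) ≡⟨ ≡.trans (length-pack (drop i w)) (length-drop i w) ⟩
        length w ∸ i             ≤⟨ ℕ.∸-monoʳ-≤ (length w) (ℕ.m≤n⊓o⇒m≤n i _ p≤i⊓|w|) ⟩
        length w ∸ p             <⟨ ℕ.∸-monoˡ-< |w|<p+q (ℕ.m≤n⊓o⇒m≤o i _ p≤i⊓|w|) ⟩
        (p ℕ.+ q) ∸ p            ≡⟨ ℕ.m+n∸m≡n p q ⟩
        q                        ∎
        where open ℕ.≤-Reasoning

  powS-vanishesBelow : ∀ {f} → VanishesBelow 1 f → ∀ m → VanishesBelow m (powS f m)
  powS-vanishesBelow f≈0 zero    w ()
  powS-vanishesBelow f≈0 (suc m) = *S-vanishesBelow f≈0 (powS-vanishesBelow f≈0 m)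

module Action {c ℓ a ℓa} (K : Field c ℓ) (A : CommAlgebra K a ℓa) where
  open Field K
  open Series K
  open QS K A
  open CommAlgebra A using (_≈ᴹ_; _+ᴹ_; _*ₗ_)
  open Vanishing K

  -- The projection QS(A) → A^{⊗0} = K; it respects ≋ because multilinearity
  -- relations only involve tensors of positive length.
  scalarPart : Tm → Carrier
  scalarPart 0t             = 0#
  scalarPart (x ⊕ y)        = scalarPart x + scalarPart y
  scalarPart (k ⊙ x)        = k * scalarPart x
  scalarPart (pure [])      = 1#
  scalarPart (pure (_ ∷ _)) = 0#

  scalarPart-pure-∷ : ∀ as x bs → scalarPart (pure (as ++ x ∷ bs)) ≡ 0#
  scalarPart-pure-∷ []      x bs = ≡.refl
  scalarPart-pure-∷ (_ ∷ _) x bs = ≡.refl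

  scalarPart-pointwise : ∀ {as bs} → Pointwise _≈ᴹ_ as bs →
                         scalarPart (pure as) ≈ scalarPart (pure bs)
  scalarPart-pointwise []      = refl
  scalarPart-pointwise (_ ∷ _) = refl

  scalarPart-cong : ∀ {x y} → x ≋ y → scalarPart x ≈ scalarPart y
  scalarPart-cong ≋-refl                = refl
  scalarPart-cong (≋-sym p)             = sym (scalarPart-cong p)
  scalarPart-cong (≋-trans p q)         = trans (scalarPart-cong p) (scalarPart-cong q)
  scalarPart-cong (⊕-cong p q)          = +-cong (scalarPart-cong p) (scalarPart-cong q)
  scalarPart-cong (⊙-cong k≈l p)        = *-cong k≈l (scalarPart-cong p)
  scalarPart-cong (⊕-assoc _ _ _)       = +-assoc _ _ _
  scalarPart-cong (⊕-comm _ _)          = +-comm _ _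
  scalarPart-cong (⊕-idˡ _)             = +-identityˡ _
  scalarPart-cong (⊙-one _)             = *-identityˡ _
  scalarPart-cong (⊙-zero _)            = zeroˡ _
  scalarPart-cong (⊙-assoc _ _ _)       = sym (*-assoc _ _ _)
  scalarPart-cong (⊙-distˡ _ _ _)       = distribˡ _ _ _
  scalarPart-cong (⊙-distʳ _ _ _)       = distribʳ _ _ _
  scalarPart-cong (pure-cong p)         = scalarPart-pointwise p
  scalarPart-cong (pure-add as x y bs)
    rewrite scalarPart-pure-∷ as (x +ᴹ y) bs
          | scalarPart-pure-∷ as x bs
          | scalarPart-pure-∷ as y bs
    = sym (+-identityˡ 0#)
  scalarPart-cong (pure-scal as k x bs)
    rewrite scalarPart-pure-∷ as (k *ₗ x) bs | scalarPart-pure-∷ as x bs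
    = sym (zeroʳ k)

  zeroConnected⇒vanishesBelow1 : ∀ {f} → ZeroConnected f → VanishesBelow 1 f
  zeroConnected⇒vanishesBelow1 {f} zc [] _ = begin
    f []            ≈⟨ sym (*-identityʳ _) ⟩
    f [] * 1#       ≈⟨ sym (+-identityʳ _) ⟩
    f [] * 1# + 0#  ≈⟨ scalarPart-cong (zc (pure []) z≤n) ⟩
    0#              ∎
    where open import Relation.Binary.Reasoning.Setoid setoid
  zeroConnected⇒vanishesBelow1 _ (_ ∷ _) (s≤s ())

  ⊙-zeroʳ : ∀ k → k ⊙ 0t ≋ 0t
  ⊙-zeroʳ k = ≋-trans (⊙-cong refl (≋-sym (⊙-zero 0t)))
             (≋-trans (⊙-assoc k 0# 0t)
             (≋-trans (⊙-cong (zeroʳ k) ≋-refl) (⊙-zero 0t)))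

  sumTm-map-≋0 : ∀ {P : Word → Set} (h : Word → Tm) → (∀ {u} → P u → h u ≋ 0t) →
                 ∀ {us} → All P us → sumTm (map h us) ≋ 0t
  sumTm-map-≋0 h h≋0 []         = ≋-refl
  sumTm-map-≋0 h h≋0 (pu ∷ pus) = ≋-trans (⊕-cong (h≋0 pu) (sumTm-map-≋0 h h≋0 pus))
                                          (⊕-idˡ 0t)

  vanishesBelow⇒actsAsZero : ∀ {n g} → VanishesBelow (suc n) g → ActsAsZeroOn≤ n g
  vanishesBelow⇒actsAsZero {n} {g} g≈0 = go
    where
    go : ∀ t → InDeg≤ n t → act g t ≋ 0t
    go 0t        _         = ≋-refl
    go (x ⊕ y)   (dx , dy) = ≋-trans (⊕-cong (go x dx) (go y dy)) (⊕-idˡ 0t)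
    go (k ⊙ x)   dx        = ≋-trans (⊙-cong refl (go x dx)) (⊙-zeroʳ k)
    go (pure as) |as|≤n    = sumTm-map-≋0 _ term (length-packedWords (length as))
      where
      term : ∀ {u} → length u ≡ length as → g u ⊙ blockTensor u as ≋ 0t
      term {u} |u|≡|as| = ≋-trans (⊙-cong (g≈0 u |u|<suc-n) ≋-refl) (⊙-zero _)
        where
        |u|<suc-n : length u < suc n
        |u|<suc-n = s≤s (≡.subst (_≤ n) (≡.sym |u|≡|as|) |as|≤n)

mainTheorem6 : {c ℓ a ℓa : Level} (K : Field c ℓ) → CharZero K →
    (A : CommAlgebra K a ℓa) → (n : ℕ) → (f : Series.Ser K) →
    Series.Car K f → QS.ZeroConnected K A f →
    QS.ActsAsZeroOn≤ K A n (Series.powS K f (suc n))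
mainTheorem6 K _ A n f _ zc =
  vanishesBelow⇒actsAsZero
    (Vanishing.powS-vanishesBelow K (zeroConnected⇒vanishesBelow1 zc) (suc n))
  where open Action K A
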